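{- Let $\mathbf A$ be a finite symmetric relation algebra with a normal representation $\mathfrak B$ such that $\mathfrak B$ has a binary injective polymorphism. Then $\mathbf A$ has all $1$-cycles, i.e., $(a,a,a)$ is an allowed triple of $\mathbf A$ for every atom $a$ of $\mathbf A$.
   Context: A relation algebra $\mathbf A=(A;\cup,\bar{\ },0,1,\mathrm{id},\breve{\ },\circ)$ (Tarski's axioms) is symmetric if $\breve a=a$ for all $a\in A$. Its atoms $A_0$ are the minimal elements of $A\setminus\{0\}$ in the Boolean order. A triple $(x,y,z)\in A_0^3$ is allowed if $z\le x\circ y$. A representation of $\mathbf A$ is a structure $\mathfrak B$ with a binary relation $a^{\mathfrak B}$ for each $a\in A$ such that $a\mapsto a^{\mathfrak B}$ is an isomorphism onto an algebra of binary relations on the domain $B$ with union, relative complement w.r.t. $1^{\mathfrak B}$, empty set, identity relation, converse and relational composition. An $\mathbf A$-network $(V;f)$ (finite $V$, partial $f\colon V^2\to A$) is closed if $f$ is total and for all $x,y,z\in V$: $f(x,x)\le\mathrm{id}$, $f(x,y)=\breve{a}$ where $a=f(y,x)$, and $f(x,z)\le f(x,y)\circ f(y,z)$; it is atomic if all values are atoms; it is satisfiable in $\mathfrak B$ if some $s\colon V\to B$ has $(s(x),s(y))\in f(x,y)^{\mathfrak B}$ for all $(x,y)$ in the domain of $f$. A representation is normal if it is square ($1^{\mathfrak B}=B^2$), homogeneous (every isomorphism between finite substructures extends to an automorphism), and fully universal (every atomic closed network is satisfiable in it). A binary polymorphism is a homomorphism $\mathfrak B^2\to\mathfrak B$. 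-}

module Defs where

open import Data.Nat using (ℕ)
open import Data.Fin using (Fin)
open import Data.Empty using (⊥)
open import Data.Product using (Σ; ∃; _×_; _,_)
open import Data.Sum using (_⊎_)
open import Relation.Nullary using (¬_)
open import Relation.Binary.PropositionalEquality using (_≡_; _≢_)
open import Function.Bundles using (_⇔_; _↔_; _⤖_; Bijection)

record RelationAlgebra : Set₁ where
  infixl 6 _∪_
  infixl 7 _∘_
  infix 4 _≤_
  field
    Carrier : Set
    _∪_     : Carrier → Carrier → Carrier
    ∁       : Carrier → Carrier
    zero    : Carrier
    one     : Carrier
    ide     : Carrier
    conv    : Carrier → Carrier
    _∘_     : Carrier → Carrier → Carrier
    ∪-comm     : ∀ x y → x ∪ y ≡ y ∪ x
    ∪-assoc    : ∀ x y z → x ∪ (y ∪ z) ≡ (x ∪ y) ∪ z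
    huntington : ∀ x y → ∁ (∁ x ∪ y) ∪ ∁ (∁ x ∪ ∁ y) ≡ x
    one-def    : ∀ x → one ≡ x ∪ ∁ x
    zero-def   : zero ≡ ∁ one
    ∘-assoc    : ∀ x y z → x ∘ (y ∘ z) ≡ (x ∘ y) ∘ z
    ∘-distribʳ : ∀ x y z → (x ∪ y) ∘ z ≡ (x ∘ z) ∪ (y ∘ z)
    ∘-identityʳ : ∀ x → x ∘ ide ≡ x
    conv-invol : ∀ x → conv (conv x) ≡ x
    conv-∪     : ∀ x y → conv (x ∪ y) ≡ conv x ∪ conv y
    conv-∘     : ∀ x y → conv (x ∘ y) ≡ conv y ∘ conv x
    tarski     : ∀ x y → (conv x ∘ ∁ (x ∘ y)) ∪ ∁ y ≡ ∁ y

  _≤_ : Carrier → Carrier → Set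
  x ≤ y = x ∪ y ≡ y

  IsAtom : Carrier → Set
  IsAtom a = (a ≢ zero) × (∀ b → b ≤ a → b ≢ zero → b ≡ a)

  Allowed : Carrier → Carrier → Carrier → Set
  Allowed x y z = IsAtom x × IsAtom y × IsAtom z × (z ≤ x ∘ y)

  IsSymmetric : Set
  IsSymmetric = ∀ a → conv a ≡ a

  IsFinite : Set
  IsFinite = Σ ℕ λ n → Carrier ↔ Fin n

  -- A-networks with vertex set Fin n that are total (as required by closedness)
  record Network : Set where
    field
      size : ℕ
      lab  : Fin size → Fin size → Carrier

  IsClosed : Network → Set
  IsClosed N = (∀ x → lab x x ≤ ide)
             × (∀ x y → lab x y ≡ conv (lab y x))
             × (∀ x y z → lab x z ≤ (lab x y ∘ lab y z))
    where open Network N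

  IsAtomic : Network → Set
  IsAtomic N = ∀ x y → IsAtom (Network.lab N x y)

record Structure (𝐀 : RelationAlgebra) : Set₁ where
  open RelationAlgebra 𝐀
  field
    Dom : Set
    rel : Carrier → Dom → Dom → Set

module _ {𝐀 : RelationAlgebra} where
  open RelationAlgebra 𝐀

  module _ (𝔅 : Structure 𝐀) where
    open Structure 𝔅

    -- a ↦ a^𝔅 is an isomorphism onto an algebra of binary relations
    -- (relations compared extensionally)
    record IsRepresentation : Set where
      field
        rel-∪    : ∀ a b x y → rel (a ∪ b) x y ⇔ (rel a x y ⊎ rel b x y)
        rel-∁    : ∀ a x y → rel (∁ a) x y ⇔ (rel one x y × ¬ rel a x y)
        rel-zero : ∀ x y → rel zero x y ⇔ ⊥
        rel-ide  : ∀ x y → rel ide x y ⇔ (x ≡ y)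
        rel-conv : ∀ a x y → rel (conv a) x y ⇔ rel a y x
        rel-∘    : ∀ a b x y → rel (a ∘ b) x y ⇔ (∃ λ z → rel a x z × rel b z y)
        rel-inj  : ∀ a b → (∀ x y → rel a x y ⇔ rel b x y) → a ≡ b

    IsSquare : Set
    IsSquare = ∀ x y → rel one x y

    IsAutomorphism : (Dom ⤖ Dom) → Set
    IsAutomorphism σ = ∀ a x y → rel a x y ⇔ rel a (to x) (to y)
      where open Bijection σ

    -- every isomorphism between finite substructures (listed as u i ↦ v i)
    -- extends to an automorphism
    IsHomogeneous : Set
    IsHomogeneous = ∀ (n : ℕ) (u v : Fin n → Dom)
      → (∀ a i j → rel a (u i) (u j) ⇔ rel a (v i) (v j))
      → Σ (Dom ⤖ Dom) λ σ → IsAutomorphism σ × (∀ i → Bijection.to σ (u i) ≡ v i)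

    SatisfiableIn : Network → Set
    SatisfiableIn N = Σ (Fin size → Dom) λ s → ∀ x y → rel (lab x y) (s x) (s y)
      where open Network N

    IsFullyUniversal : Set
    IsFullyUniversal = ∀ N → IsClosed N → IsAtomic N → SatisfiableIn N

    IsNormal : Set
    IsNormal = IsSquare × IsHomogeneous × IsFullyUniversal

    IsBinaryPolymorphism : (Dom → Dom → Dom) → Set
    IsBinaryPolymorphism h = ∀ a x₁ x₂ y₁ y₂
      → rel a x₁ y₁ → rel a x₂ y₂ → rel a (h x₁ x₂) (h y₁ y₂)

    IsInjective₂ : (Dom → Dom → Dom) → Set
    IsInjective₂ h = ∀ x₁ x₂ y₁ y₂ → h x₁ x₂ ≡ h y₁ y₂ → (x₁ ≡ y₁) × (x₂ ≡ y₂)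

{-# OPTIONS --safe #-}
-- In fact every element a satisfies a ≤ a ∘ a.  Given a-related x, y, the
-- elements h(x,x), h(x,y), h(y,y) are pairwise (a ∪ id)-related, and by
-- injectivity of h they are distinct unless x = y.  Since the square of a
-- representation reflects complements, p ↦ h(p,p) is an embedding, so by
-- homogeneity some automorphism σ sends x, y to h(x,x), h(y,y); then
-- σ⁻¹(h(x,y)) lies a-between x and y.
module Submission where

open import Defs
open import Data.Product using (Σ; ∃; _×_; _,_; proj₁; proj₂)
open import Data.Sum using (_⊎_; inj₁; inj₂; [_,_])
open import Data.Fin using (Fin; zero; suc)
open import Relation.Nullary using (¬_)
open import Relation.Binary.PropositionalEquality using (_≡_; refl; sym; subst; subst₂)
open import Function.Bundles using (_⇔_; _⤖_; Equivalence; mk⇔; Bijection)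
open RelationAlgebra using (Carrier; IsFinite; IsSymmetric; IsAtom; Allowed)

module _ {𝐀 : RelationAlgebra} {𝔅 : Structure 𝐀} (R : IsRepresentation 𝔅) where
  open RelationAlgebra 𝐀 hiding (zero)
  open Structure 𝔅
  open IsRepresentation R
  open Equivalence

  ≤-from-rel : ∀ a b → (∀ x y → rel a x y → rel b x y) → a ≤ b
  ≤-from-rel a b a⊆b = rel-inj (a ∪ b) b λ x y → mk⇔
    (λ r → [ a⊆b x y , (λ s → s) ] (to (rel-∪ a b x y) r))
    (λ s → from (rel-∪ a b x y) (inj₂ s))

  module _ (square : IsSquare 𝔅) where

    rel-∁-intro : ∀ c x y → ¬ rel c x y → rel (∁ c) x y
    rel-∁-intro c x y ¬r = from (rel-∁ c x y) (square x y , ¬r)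

    -- Huntington's axiom writes c as a join whose second part ∁(∁c ∪ ∁c)
    -- holds exactly where ∁c fails.
    rel-¬¬-stable : ∀ c x y → ¬ ¬ rel c x y → rel c x y
    rel-¬¬-stable c x y ¬¬r = subst (λ e → rel e x y) (huntington c c)
      (from (rel-∪ _ _ x y) (inj₂ (rel-∁-intro _ x y λ r∁∁ →
        ¬¬r λ r → [ ¬rel-∁ r , ¬rel-∁ r ] (to (rel-∪ _ _ x y) r∁∁))))
      where
      ¬rel-∁ : rel c x y → ¬ rel (∁ c) x y
      ¬rel-∁ r r∁ = proj₂ (to (rel-∁ c x y) r∁) r

    module _ (h : Dom → Dom → Dom) (pol : IsBinaryPolymorphism 𝔅 h) where

      diagonal-embedding : ∀ c x y → rel c x y ⇔ rel c (h x x) (h y y)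
      diagonal-embedding c x y = mk⇔ (λ r → pol c x x y y r r)
        (λ r → rel-¬¬-stable c x y λ ¬r →
          let r∁ = rel-∁-intro c x y ¬r
          in proj₂ (to (rel-∁ c _ _) (pol (∁ c) x x y y r∁ r∁)) r)

      rel-∪-ide-steps : ∀ a x y → rel a x y
        → rel (a ∪ ide) (h x x) (h x y) × rel (a ∪ ide) (h x y) (h y y)
      rel-∪-ide-steps a x y r =
          pol _ x x x y (reflexive x) (from (rel-∪ a ide x y) (inj₁ r))
        , pol _ x y y y (from (rel-∪ a ide x y) (inj₁ r)) (reflexive y)
        where
        reflexive : ∀ p → rel (a ∪ ide) p p
        reflexive p = from (rel-∪ a ide p p) (inj₂ (from (rel-ide p p) refl))

  module _ (homogeneous : IsHomogeneous 𝔅) where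

    extend-embedding : (e : Dom → Dom) → (∀ c p q → rel c p q ⇔ rel c (e p) (e q))
      → ∀ x y → Σ (Dom ⤖ Dom) λ σ → IsAutomorphism 𝔅 σ
                × Bijection.to σ x ≡ e x × Bijection.to σ y ≡ e y
    extend-embedding e emb x y with homogeneous 2 pair (λ i → e (pair i)) (λ c i j → emb c (pair i) (pair j))
      where
      pair : Fin 2 → Dom
      pair zero    = x
      pair (suc _) = y
    ... | σ , aut , fixes = σ , aut , fixes zero , fixes (suc zero)

  module _ (square : IsSquare 𝔅) (homogeneous : IsHomogeneous 𝔅)
           (h : Dom → Dom → Dom) (pol : IsBinaryPolymorphism 𝔅 h)
           (injective : IsInjective₂ 𝔅 h) where

    rel-interpolate : ∀ a x y → rel a x y → ∃ λ z → rel a x z × rel a z y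
    rel-interpolate a x y r
      with rel-∪-ide-steps square h pol a x y r
    ... | r₁ , r₂ = between (to (rel-∪ a ide _ _) r₁) (to (rel-∪ a ide _ _) r₂)
      where
      between : rel a (h x x) (h x y) ⊎ rel ide (h x x) (h x y)
              → rel a (h x y) (h y y) ⊎ rel ide (h x y) (h y y)
              → ∃ λ z → rel a x z × rel a z y
      between (inj₂ e) _ = x , subst (rel a x) (sym x≡y) r , r
        where x≡y = proj₂ (injective x x x y (to (rel-ide _ _) e))
      between (inj₁ _) (inj₂ e) = y , r , subst (λ w → rel a w y) x≡y r
        where x≡y = proj₁ (injective x y y y (to (rel-ide _ _) e))
      between (inj₁ s₁) (inj₁ s₂)
        with extend-embedding homogeneous (λ p → h p p)
               (diagonal-embedding square h pol) x y
      ... | σ , aut , σx , σy with Bijection.strictlySurjective σ (h x y)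
      ... | z , σz =
          z , from (aut a x z) (subst₂ (rel a) (sym σx) (sym σz) s₁)
            , from (aut a z y) (subst₂ (rel a) (sym σz) (sym σy) s₂)

    ≤-∘-self : ∀ a → a ≤ a ∘ a
    ≤-∘-self a = ≤-from-rel a (a ∘ a) λ x y r →
      from (rel-∘ a a x y) (rel-interpolate a x y r)

lemma4p3 : (𝐀 : RelationAlgebra) → IsFinite 𝐀 → IsSymmetric 𝐀
    → (𝔅 : Structure 𝐀) → IsRepresentation 𝔅 → IsNormal 𝔅
    → Σ (Structure.Dom 𝔅 → Structure.Dom 𝔅 → Structure.Dom 𝔅)
        (λ h → IsBinaryPolymorphism 𝔅 h × IsInjective₂ 𝔅 h)
    → ∀ (a : Carrier 𝐀) → IsAtom 𝐀 a → Allowed 𝐀 a a a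
lemma4p3 𝐀 _ _ 𝔅 R (square , homogeneous , _) (h , pol , injective) a atom =
  atom , atom , atom , ≤-∘-self R square homogeneous h pol injective a
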